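{- Identify $V(Q_3)$ with $\{0,1\}^3$, written as strings $000,001,\dots,111$. For every graph $G$, $$\hom(Q_3,G;\{000,011\})^2\leq \hom(Q_3,G;\{000,011,101\})\,\hom(Q_3,G)$$ and $$\hom(Q_3,G;\{000,011,101\})^2\leq \hom(Q_3,G;\{000,011,101,110\})\,\hom(Q_3,G).$$
   Context: $Q_3$ is the graph on $\{0,1\}^3$ in which two vertices are adjacent iff they differ in exactly one coordinate. A homomorphism $H\to G$ is a map $V(H)\to V(G)$ sending edges to edges; $\hom(H,G)$ is the number of homomorphisms, and for $R\subset V(H)$, $\hom(H,G;R)$ is the number of homomorphisms $H\to G$ mapping all vertices of $R$ to the same vertex of $G$. -}

module Defs where

open import Data.Nat using (ℕ; zero; suc; _+_; _*_)
open import Data.Bool using (Bool; true; false; _∧_; if_then_else_)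
open import Data.Fin using (Fin)
open import Data.Fin.Properties using () renaming (_≟_ to _≟F_)
open import Data.Vec using (Vec; []; _∷_; lookup)
open import Data.List using (List; []; _∷_; map; concatMap; filter; length; allFin)
open import Relation.Nullary.Decidable using (⌊_⌋)
open import Relation.Binary.PropositionalEquality using (_≡_)

record Graph : Set where
  field
    n     : ℕ
    adj   : Fin n → Fin n → Bool
    sym   : ∀ i j → adj i j ≡ adj j i
    loopless : ∀ i → adj i i ≡ false
open Graph public

-- Vertices of Q_3: {0,1}^3 as Boolean vectors (false = 0, true = 1),
-- written as strings b₁b₂b₃.
Cube : Set
Cube = Vec Bool 3

allBits : (k : ℕ) → List (Vec Bool k)
allBits zero = [] ∷ []
allBits (suc k) = concatMap (λ v → (false ∷ v) ∷ (true ∷ v) ∷ []) (allBits k)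

allB : {A : Set} → (A → Bool) → List A → Bool
allB p [] = true
allB p (x ∷ xs) = p x ∧ allB p xs

xor : Bool → Bool → Bool
xor false b = b
xor true false = true
xor true true = false

bit : Bool → ℕ
bit false = 0
bit true = 1

hamming : ∀ {k} → Vec Bool k → Vec Bool k → ℕ
hamming [] [] = 0
hamming (a ∷ u) (b ∷ v) = bit (xor a b) + hamming u v

isOne : ℕ → Bool
isOne (suc zero) = true
isOne _ = false

Q3adj : Cube → Cube → Bool
Q3adj u v = isOne (hamming u v)

-- binary value of a string b₁…b_k (b₁ most significant), used to index
-- a map V(Q_3) → V(G) stored as a vector of length 8
binIndex : Cube → Fin 8
binIndex (a ∷ b ∷ c ∷ []) = go a b c
  where
  go : Bool → Bool → Bool → Fin 8
  go false false false = Fin.zero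
  go false false true  = Fin.suc Fin.zero
  go false true  false = Fin.suc (Fin.suc Fin.zero)
  go false true  true  = Fin.suc (Fin.suc (Fin.suc Fin.zero))
  go true  false false = Fin.suc (Fin.suc (Fin.suc (Fin.suc Fin.zero)))
  go true  false true  = Fin.suc (Fin.suc (Fin.suc (Fin.suc (Fin.suc Fin.zero))))
  go true  true  false = Fin.suc (Fin.suc (Fin.suc (Fin.suc (Fin.suc (Fin.suc Fin.zero)))))
  go true  true  true  = Fin.suc (Fin.suc (Fin.suc (Fin.suc (Fin.suc (Fin.suc (Fin.suc Fin.zero))))))

allVecs : (m k : ℕ) → List (Vec (Fin m) k)
allVecs m zero = [] ∷ []
allVecs m (suc k) = concatMap (λ v → map (λ x → x ∷ v) (allFin m)) (allVecs m k)

Map : Graph → Set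
Map G = Vec (Fin (n G)) 8

apply : (G : Graph) → Map G → Cube → Fin (n G)
apply G f v = lookup f (binIndex v)

isHom : (G : Graph) → Map G → Bool
isHom G f = allB (λ u → allB (λ v → if Q3adj u v then adj G (apply G f u) (apply G f v) else true) (allBits 3)) (allBits 3)

constOn : (G : Graph) → Map G → List Cube → Bool
constOn G f R = allB (λ u → allB (λ v → ⌊ apply G f u ≟F apply G f v ⌋) R) R

hom : Graph → ℕ
hom G = length (filter (λ f → isHom G f Data.Bool.≟ true) (allVecs (n G) 8))
  where import Data.Bool

homR : Graph → List Cube → ℕ
homR G R = length (filter (λ f → (isHom G f ∧ constOn G f R) Data.Bool.≟ true) (allVecs (n G) 8))
  where import Data.Bool

v000 v011 v101 v110 : Cube
v000 = false ∷ false ∷ false ∷ []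
v011 = false ∷ true ∷ true ∷ []
v101 = true ∷ false ∷ true ∷ []
v110 = true ∷ true ∷ false ∷ []

-- Fix the images of the vertices in a suitable "boundary" of Q₃. In the
-- first inequality the boundary is {111, 110, 001} together with the common
-- image of 000 = 011; the remaining vertices split into {010} and
-- {100, 101}, which share no edge, so hom(Q₃, G; {000, 011}) = Σ u v with u
-- counting images of 010 and v images of (100, 101). Identifying 101 with 000
-- as well makes (100, 101) behave like 010, so hom(Q₃, G; {000, 011, 101})
-- = Σ u², while releasing 011 makes (010, 011) a second copy of (100, 101),
-- so hom(Q₃, G) = Σ v². Cauchy–Schwarz gives the first inequality. The second
-- is the same argument with boundary {111, 010} and the common image of
-- 000 = 011 = 101, the two halves being {001} and {110, 100}; there the
-- square of the second half counts hom(Q₃, G; {000, 101}) ≤ hom(Q₃, G).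

module Submission where

open import Data.Bool using (Bool; true; false; _∧_; _∨_; if_then_else_) renaming (_≟_ to _≟ᵇ_)
open import Data.Bool.Properties using (∧-assoc; ∧-idem; ∧-identityʳ; ∧-conicalˡ; ∧-conicalʳ; T-≡; ⇔→≡)
open import Data.Fin using (Fin; zero; suc)
open import Data.Fin.Patterns using (0F; 1F; 2F; 3F; 4F; 5F; 6F; 7F)
open import Data.Fin.Properties using (_≟_)
open import Data.List using (List; []; _∷_; _++_; map; concatMap; filter; length; allFin; tabulate)
open import Data.List.Properties using (map-++; map-tabulate; map-cong)
open import Data.Nat using (ℕ; zero; suc; _+_; _*_; _∸_; _≤_; z≤n)
open import Data.Nat.ListAction using () renaming (sum to sumˡ)
open import Data.Nat.ListAction.Properties using () renaming (sum-++ to sumˡ-++)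
open import Data.Nat.Properties hiding (_≟_)
open import Algebra.Properties.Semiring.Sum +-*-semiring
  using (sum; sum-syntax; sum-cong-≗; sum-replicate-zero; ∑-comm; *-distribˡ-sum; *-distribʳ-sum)
open import Data.Nat.Tactic.RingSolver using (solve-∀)
open import Data.Product using (_×_; _,_; proj₁; proj₂)
open import Data.Sum using (inj₁; inj₂)
open import Data.Vec using (Vec; []; _∷_; lookup)
open import Defs renaming (sym to adj-sym)
open import Function using (_∘_; Equivalence; mk⇔)
open import Relation.Binary.PropositionalEquality
open import Relation.Nullary.Decidable using (⌊_⌋; yes; no; toWitness; fromWitness)
open import Relation.Nullary.Negation using (contradiction)

𝟙 : Bool → ℕ
𝟙 true = 1
𝟙 false = 0

𝟙-∧ : ∀ b c → 𝟙 (b ∧ c) ≡ 𝟙 b * 𝟙 c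
𝟙-∧ true c = sym (+-identityʳ (𝟙 c))
𝟙-∧ false c = refl

𝟙-∧-≤ : ∀ b c → 𝟙 (b ∧ c) ≤ 𝟙 b
𝟙-∧-≤ true true = ≤-refl
𝟙-∧-≤ true false = z≤n
𝟙-∧-≤ false c = ≤-refl

𝟙-∧-∧ : ∀ b e a → 𝟙 (b ∧ (e ∧ a)) ≡ 𝟙 (b ∧ a) * 𝟙 e
𝟙-∧-∧ true true a = sym (*-identityʳ (𝟙 a))
𝟙-∧-∧ true false a = sym (*-zeroʳ (𝟙 a))
𝟙-∧-∧ false e a = refl

-- sum-cong-≗, restated so that the length can be inferred from the goal.
∑-cong : ∀ {n} {f g : Fin n → ℕ} → (∀ i → f i ≡ g i) → sum f ≡ sum g
∑-cong = sum-cong-≗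

∑-mono-≤ : ∀ {n} {f g : Fin n → ℕ} → (∀ i → f i ≤ g i) → sum f ≤ sum g
∑-mono-≤ {zero} f≤g = ≤-refl
∑-mono-≤ {suc n} f≤g = +-mono-≤ (f≤g zero) (∑-mono-≤ (f≤g ∘ suc))

∑-product : ∀ {n} (f g : Fin n → ℕ) → sum f * sum g ≡ ∑[ i < n ] ∑[ j < n ] (f i * g j)
∑-product f g = trans (*-distribʳ-sum (sum g) f) (∑-cong λ i → *-distribˡ-sum (f i) g)

∑₂-product-∑ : ∀ {m} (f : Fin m → Fin m → ℕ) (g : Fin m → ℕ) →
  (∑[ a < m ] ∑[ b < m ] f a b) * sum g ≡ ∑[ a < m ] ∑[ b < m ] ∑[ c < m ] (f a b * g c)
∑₂-product-∑ {m} f g = trans (∑-product (λ a → ∑[ b < m ] f a b) g)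
  (∑-cong λ a → trans (∑-cong λ c → *-distribʳ-sum (g c) (f a)) (∑-comm λ c b → f a b * g c))

∑₂-product-∑₂ : ∀ {m} (f g : Fin m → Fin m → ℕ) →
  (∑[ a < m ] ∑[ b < m ] f a b) * (∑[ c < m ] ∑[ d < m ] g c d)
    ≡ ∑[ a < m ] ∑[ b < m ] ∑[ c < m ] ∑[ d < m ] (f a b * g c d)
∑₂-product-∑₂ {m} f g = trans (∑₂-product-∑ f (λ c → ∑[ d < m ] g c d))
  (∑-cong λ a → ∑-cong λ b → ∑-cong λ c → *-distribˡ-sum (f a b) (g c))

∑-rotate₃ : ∀ {m} (f : Fin m → Fin m → Fin m → ℕ) →
  ∑[ a < m ] ∑[ b < m ] ∑[ c < m ] f a b c ≡ ∑[ c < m ] ∑[ a < m ] ∑[ b < m ] f a b c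
∑-rotate₃ {m} f = trans (∑-cong λ a → ∑-comm (f a)) (∑-comm λ a c → ∑[ b < m ] f a b c)

∑-rotate₄ : ∀ {m} (f : Fin m → Fin m → Fin m → Fin m → ℕ) →
  ∑[ a < m ] ∑[ b < m ] ∑[ c < m ] ∑[ d < m ] f a b c d
    ≡ ∑[ d < m ] ∑[ a < m ] ∑[ b < m ] ∑[ c < m ] f a b c d
∑-rotate₄ {m} f = trans (∑-cong λ a → ∑-rotate₃ (f a)) (∑-comm λ a d → ∑[ b < m ] ∑[ c < m ] f a b c d)

∑-rotate₅ : ∀ {m} (f : Fin m → Fin m → Fin m → Fin m → Fin m → ℕ) →
  ∑[ a < m ] ∑[ b < m ] ∑[ c < m ] ∑[ d < m ] ∑[ e < m ] f a b c d e
    ≡ ∑[ e < m ] ∑[ a < m ] ∑[ b < m ] ∑[ c < m ] ∑[ d < m ] f a b c d e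
∑-rotate₅ {m} f = trans (∑-cong λ a → ∑-rotate₄ (f a))
  (∑-comm λ a e → ∑[ b < m ] ∑[ c < m ] ∑[ d < m ] f a b c d e)

∑-rotate₆ : ∀ {m} (f : Fin m → Fin m → Fin m → Fin m → Fin m → Fin m → ℕ) →
  ∑[ a < m ] ∑[ b < m ] ∑[ c < m ] ∑[ d < m ] ∑[ e < m ] ∑[ g < m ] f a b c d e g
    ≡ ∑[ g < m ] ∑[ a < m ] ∑[ b < m ] ∑[ c < m ] ∑[ d < m ] ∑[ e < m ] f a b c d e g
∑-rotate₆ {m} f = trans (∑-cong λ a → ∑-rotate₅ (f a))
  (∑-comm λ a g → ∑[ b < m ] ∑[ c < m ] ∑[ d < m ] ∑[ e < m ] f a b c d e g)

≟-refl : ∀ {n} (c : Fin n) → ⌊ c ≟ c ⌋ ≡ true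
≟-refl c = Equivalence.to T-≡ (fromWitness refl)

≟-sound : ∀ {n} {i j : Fin n} → ⌊ i ≟ j ⌋ ≡ true → i ≡ j
≟-sound h = toWitness (Equivalence.from T-≡ h)

≟-suc : ∀ {n} (x c : Fin n) → ⌊ suc x ≟ suc c ⌋ ≡ ⌊ x ≟ c ⌋
≟-suc x c with x ≟ c
... | yes _ = refl
... | no _ = refl

∑-select : ∀ {n} (f : Fin n → ℕ) (c : Fin n) → ∑[ x < n ] (f x * 𝟙 ⌊ x ≟ c ⌋) ≡ f c
∑-select {suc n} f zero = begin
  f zero * 1 + ∑[ x < n ] (f (suc x) * 0) ≡⟨ cong₂ _+_ (*-identityʳ (f zero)) (∑-cong (*-zeroʳ ∘ f ∘ suc)) ⟩
  f zero + ∑[ x < n ] 0                   ≡⟨ cong (f zero +_) (sum-replicate-zero n) ⟩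
  f zero + 0                              ≡⟨ +-identityʳ (f zero) ⟩
  f zero ∎
  where open ≡-Reasoning
∑-select {suc n} f (suc c) = begin
  f zero * 0 + ∑[ x < n ] (f (suc x) * 𝟙 ⌊ suc x ≟ suc c ⌋)
    ≡⟨ cong₂ _+_ (*-zeroʳ (f zero)) (∑-cong λ x → cong (λ b → f (suc x) * 𝟙 b) (≟-suc x c)) ⟩
  ∑[ x < n ] (f (suc x) * 𝟙 ⌊ x ≟ c ⌋)
    ≡⟨ ∑-select (f ∘ suc) c ⟩
  f (suc c) ∎
  where open ≡-Reasoning

-- Cauchy–Schwarz
4*-≤-square-+ : ∀ a k → 4 * (a * (a + k)) ≤ (a + (a + k)) * (a + (a + k))
4*-≤-square-+ a k = subst (4 * (a * (a + k)) ≤_) (square-gap a k) (m≤m+n _ (k * k))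
  where
  square-gap : ∀ a k → 4 * (a * (a + k)) + k * k ≡ (a + (a + k)) * (a + (a + k))
  square-gap = solve-∀

4*-≤-square-≤ : ∀ {a b} → a ≤ b → 4 * (a * b) ≤ (a + b) * (a + b)
4*-≤-square-≤ {a} {b} a≤b =
  subst (λ c → 4 * (a * c) ≤ (a + c) * (a + c)) (m+[n∸m]≡n a≤b) (4*-≤-square-+ a (b ∸ a))

4*-≤-square : ∀ a b → 4 * (a * b) ≤ (a + b) * (a + b)
4*-≤-square a b with ≤-total a b
... | inj₁ a≤b = 4*-≤-square-≤ a≤b
... | inj₂ b≤a =
  subst₂ _≤_ (cong (4 *_) (*-comm b a)) (cong₂ _*_ (+-comm b a) (+-comm b a)) (4*-≤-square-≤ b≤a)

m*m≤n*n⇒m≤n : ∀ {m n} → m * m ≤ n * n → m ≤ n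
m*m≤n*n⇒m≤n {m} {n} m²≤n² with ≤-<-connex m n
... | inj₁ m≤n = m≤n
... | inj₂ n<m = contradiction m²≤n² (<⇒≱ (*-mono-< n<m n<m))

-- The cross term is handled by AM-GM: (2x₁x₂)² ≤ 4(u₁v₂)(u₂v₁) ≤ (u₁v₂ + u₂v₁)².
cauchy-schwarz-+ : ∀ {x₁ x₂ u₁ u₂ v₁ v₂} → x₁ * x₁ ≤ u₁ * v₁ → x₂ * x₂ ≤ u₂ * v₂ →
  (x₁ + x₂) * (x₁ + x₂) ≤ (u₁ + u₂) * (v₁ + v₂)
cauchy-schwarz-+ {x₁} {x₂} {u₁} {u₂} {v₁} {v₂} h₁ h₂ =
  subst₂ _≤_ (expand-x x₁ x₂) (expand-uv u₁ u₂ v₁ v₂) (+-mono-≤ h₁ (+-mono-≤ cross h₂))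
  where
  cross-square : (2 * (x₁ * x₂)) * (2 * (x₁ * x₂)) ≤ (u₁ * v₂ + u₂ * v₁) * (u₁ * v₂ + u₂ * v₁)
  cross-square = begin
    (2 * (x₁ * x₂)) * (2 * (x₁ * x₂)) ≡⟨ square-double x₁ x₂ ⟩
    4 * ((x₁ * x₁) * (x₂ * x₂))       ≤⟨ *-monoʳ-≤ 4 (*-mono-≤ h₁ h₂) ⟩
    4 * ((u₁ * v₁) * (u₂ * v₂))       ≡⟨ cong (4 *_) (regroup u₁ v₁ u₂ v₂) ⟩
    4 * ((u₁ * v₂) * (u₂ * v₁))       ≤⟨ 4*-≤-square (u₁ * v₂) (u₂ * v₁) ⟩
    (u₁ * v₂ + u₂ * v₁) * (u₁ * v₂ + u₂ * v₁) ∎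
    where
    open ≤-Reasoning
    square-double : ∀ x y → (2 * (x * y)) * (2 * (x * y)) ≡ 4 * ((x * x) * (y * y))
    square-double = solve-∀
    regroup : ∀ a b c d → (a * b) * (c * d) ≡ (a * d) * (c * b)
    regroup = solve-∀
  cross : 2 * (x₁ * x₂) ≤ u₁ * v₂ + u₂ * v₁
  cross = m*m≤n*n⇒m≤n cross-square
  expand-x : ∀ x y → x * x + (2 * (x * y) + y * y) ≡ (x + y) * (x + y)
  expand-x = solve-∀
  expand-uv : ∀ a b c d → a * c + ((a * d + b * c) + b * d) ≡ (a + b) * (c + d)
  expand-uv = solve-∀

product-square-≤ : ∀ u v → (u * v) * (u * v) ≤ (v * v) * (u * u)
product-square-≤ u v = ≤-reflexive (rearrange u v)
  where
  rearrange : ∀ u v → (u * v) * (u * v) ≡ (v * v) * (u * u)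
  rearrange = solve-∀

∑-cauchy-schwarz : ∀ {n} {x u v : Fin n → ℕ} → (∀ i → x i * x i ≤ u i * v i) →
  sum x * sum x ≤ sum u * sum v
∑-cauchy-schwarz {zero} h = z≤n
∑-cauchy-schwarz {suc n} {x} {u} {v} h =
  cauchy-schwarz-+ {x zero} {sum (x ∘ suc)} {u zero} {sum (u ∘ suc)} {v zero} {sum (v ∘ suc)}
    (h zero) (∑-cauchy-schwarz (h ∘ suc))

-- Homomorphism counts as iterated sums
∑ᵛ : ∀ {m} k → (Vec (Fin m) k → ℕ) → ℕ
∑ᵛ zero g = g []
∑ᵛ {m} (suc k) g = ∑ᵛ k (λ v → ∑[ x < m ] g (x ∷ v))

∑ᵛ-cong : ∀ {m} k {f g : Vec (Fin m) k → ℕ} → (∀ v → f v ≡ g v) → ∑ᵛ k f ≡ ∑ᵛ k g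
∑ᵛ-cong zero f≗g = f≗g []
∑ᵛ-cong (suc k) f≗g = ∑ᵛ-cong k (λ v → ∑-cong (λ x → f≗g (x ∷ v)))

∑ᵛ-mono-≤ : ∀ {m} k {f g : Vec (Fin m) k → ℕ} → (∀ v → f v ≤ g v) → ∑ᵛ k f ≤ ∑ᵛ k g
∑ᵛ-mono-≤ zero f≤g = f≤g []
∑ᵛ-mono-≤ (suc k) f≤g = ∑ᵛ-mono-≤ k (λ v → ∑-mono-≤ (λ x → f≤g (x ∷ v)))

∑ᵛ-*ʳ : ∀ {m} k (f : Vec (Fin m) k → ℕ) c → ∑ᵛ k (λ v → f v * c) ≡ ∑ᵛ k f * c
∑ᵛ-*ʳ zero f c = refl
∑ᵛ-*ʳ {m} (suc k) f c = trans
  (∑ᵛ-cong k (λ v → sym (*-distribʳ-sum c (λ x → f (x ∷ v)))))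
  (∑ᵛ-*ʳ k (λ v → ∑[ x < m ] f (x ∷ v)) c)

length-filter-≡-∑𝟙 : ∀ {A : Set} (P : A → Bool) (xs : List A) →
  length (filter (λ x → P x ≟ᵇ true) xs) ≡ sumˡ (map (𝟙 ∘ P) xs)
length-filter-≡-∑𝟙 P [] = refl
length-filter-≡-∑𝟙 P (x ∷ xs) with P x
... | true = cong suc (length-filter-≡-∑𝟙 P xs)
... | false = length-filter-≡-∑𝟙 P xs

sumˡ-concatMap : ∀ {A B : Set} (g : B → ℕ) (h : A → List B) (xs : List A) →
  sumˡ (map g (concatMap h xs)) ≡ sumˡ (map (λ x → sumˡ (map g (h x))) xs)
sumˡ-concatMap g h [] = refl
sumˡ-concatMap g h (x ∷ xs) = begin
  sumˡ (map g (h x ++ concatMap h xs))                  ≡⟨ cong sumˡ (map-++ g (h x) (concatMap h xs)) ⟩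
  sumˡ (map g (h x) ++ map g (concatMap h xs))          ≡⟨ sumˡ-++ (map g (h x)) (map g (concatMap h xs)) ⟩
  sumˡ (map g (h x)) + sumˡ (map g (concatMap h xs))    ≡⟨ cong (sumˡ (map g (h x)) +_) (sumˡ-concatMap g h xs) ⟩
  sumˡ (map g (h x)) + sumˡ (map (λ x → sumˡ (map g (h x))) xs) ∎
  where open ≡-Reasoning

sumˡ-tabulate : ∀ {n} (f : Fin n → ℕ) → sumˡ (tabulate f) ≡ sum f
sumˡ-tabulate {zero} f = refl
sumˡ-tabulate {suc n} f = cong (f zero +_) (sumˡ-tabulate (f ∘ suc))

sumˡ-allVecs : ∀ m k (g : Vec (Fin m) k → ℕ) → sumˡ (map g (allVecs m k)) ≡ ∑ᵛ k g
sumˡ-allVecs m zero g = +-identityʳ (g [])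
sumˡ-allVecs m (suc k) g = begin
  sumˡ (map g (allVecs m (suc k)))
    ≡⟨ sumˡ-concatMap g (λ v → map (_∷ v) (allFin m)) (allVecs m k) ⟩
  sumˡ (map (λ v → sumˡ (map g (map (_∷ v) (allFin m)))) (allVecs m k))
    ≡⟨ cong sumˡ (map-cong sum-row (allVecs m k)) ⟩
  sumˡ (map (λ v → ∑[ x < m ] g (x ∷ v)) (allVecs m k))
    ≡⟨ sumˡ-allVecs m k (λ v → ∑[ x < m ] g (x ∷ v)) ⟩
  ∑ᵛ (suc k) g ∎
  where
  open ≡-Reasoning
  sum-row : ∀ v → sumˡ (map g (map (_∷ v) (allFin m))) ≡ ∑[ x < m ] g (x ∷ v)
  sum-row v = begin
    sumˡ (map g (map (_∷ v) (tabulate (λ x → x)))) ≡⟨ cong (sumˡ ∘ map g) (map-tabulate (λ x → x) (_∷ v)) ⟩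
    sumˡ (map g (tabulate (_∷ v)))                 ≡⟨ cong sumˡ (map-tabulate (_∷ v) g) ⟩
    sumˡ (tabulate (λ x → g (x ∷ v)))              ≡⟨ sumˡ-tabulate (λ x → g (x ∷ v)) ⟩
    ∑[ x < m ] g (x ∷ v) ∎

hom≡∑ᵛ : ∀ G → hom G ≡ ∑ᵛ 8 (𝟙 ∘ isHom G)
hom≡∑ᵛ G = trans (length-filter-≡-∑𝟙 (isHom G) (allVecs (n G) 8)) (sumˡ-allVecs (n G) 8 (𝟙 ∘ isHom G))

homR≡∑ᵛ : ∀ G R → homR G R ≡ ∑ᵛ 8 (λ f → 𝟙 (isHom G f ∧ constOn G f R))
homR≡∑ᵛ G R = trans (length-filter-≡-∑𝟙 P (allVecs (n G) 8)) (sumˡ-allVecs (n G) 8 (𝟙 ∘ P))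
  where P = λ f → isHom G f ∧ constOn G f R

homR≤hom : ∀ G R → homR G R ≤ hom G
homR≤hom G R = subst₂ _≤_ (sym (homR≡∑ᵛ G R)) (sym (hom≡∑ᵛ G))
  (∑ᵛ-mono-≤ 8 (λ f → 𝟙-∧-≤ (isHom G f) (constOn G f R)))

-- Identifying the images of two vertices
allB-cong : ∀ {A : Set} {p q : A → Bool} → (∀ x → p x ≡ q x) → ∀ xs → allB p xs ≡ allB q xs
allB-cong p≗q [] = refl
allB-cong p≗q (x ∷ xs) = cong₂ _∧_ (p≗q x) (allB-cong p≗q xs)

∧-dup : ∀ x y → x ∧ (x ∧ y) ≡ x ∧ y
∧-dup x y = trans (sym (∧-assoc x x y)) (cong (_∧ y) (∧-idem x))

allEqual : ∀ {m} → List (Fin m) → Bool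
allEqual xs = allB (λ a → allB (λ b → ⌊ a ≟ b ⌋) xs) xs

allEqual-∷ : ∀ {m} (p q : Fin m) L → allEqual (p ∷ q ∷ L) ≡ ⌊ p ≟ q ⌋ ∧ allEqual (q ∷ L)
allEqual-∷ p q L with p ≟ q
... | no _ rewrite ≟-refl p = refl
... | yes refl rewrite ≟-refl p = trans (∧-dup (allB (λ b → ⌊ p ≟ b ⌋) L) _)
  (cong (allB (λ b → ⌊ p ≟ b ⌋) L ∧_) (allB-cong (λ a → ∧-dup ⌊ a ≟ p ⌋ _) L))

allEqual-[-] : ∀ {m} (c : Fin m) → allEqual (c ∷ []) ≡ true
allEqual-[-] c rewrite ≟-refl c = refl

∑-identify : ∀ {m} k (P : Fin m → Vec (Fin m) k → Bool) (c : Fin m) (L : List (Fin m)) →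
  ∑[ x < m ] ∑ᵛ k (λ v → 𝟙 (P x v ∧ allEqual (x ∷ c ∷ L)))
    ≡ ∑ᵛ k (λ v → 𝟙 (P c v ∧ allEqual (c ∷ L)))
∑-identify {m} k P c L = begin
  ∑[ x < m ] ∑ᵛ k (λ v → 𝟙 (P x v ∧ allEqual (x ∷ c ∷ L)))
    ≡⟨ ∑-cong (λ x → ∑ᵛ-cong k (λ v → split x v)) ⟩
  ∑[ x < m ] ∑ᵛ k (λ v → 𝟙 (P x v ∧ allEqual (c ∷ L)) * 𝟙 ⌊ x ≟ c ⌋)
    ≡⟨ ∑-cong (λ x → ∑ᵛ-*ʳ k (λ v → 𝟙 (P x v ∧ allEqual (c ∷ L))) (𝟙 ⌊ x ≟ c ⌋)) ⟩
  ∑[ x < m ] (∑ᵛ k (λ v → 𝟙 (P x v ∧ allEqual (c ∷ L))) * 𝟙 ⌊ x ≟ c ⌋)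
    ≡⟨ ∑-select (λ x → ∑ᵛ k (λ v → 𝟙 (P x v ∧ allEqual (c ∷ L)))) c ⟩
  ∑ᵛ k (λ v → 𝟙 (P c v ∧ allEqual (c ∷ L))) ∎
  where
  open ≡-Reasoning
  split : ∀ x v → 𝟙 (P x v ∧ allEqual (x ∷ c ∷ L)) ≡ 𝟙 (P x v ∧ allEqual (c ∷ L)) * 𝟙 ⌊ x ≟ c ⌋
  split x v = trans (cong (λ b → 𝟙 (P x v ∧ b)) (allEqual-∷ x c L)) (𝟙-∧-∧ (P x v) ⌊ x ≟ c ⌋ _)

∑-identify-last : ∀ {m} k (P : Fin m → Vec (Fin m) k → Bool) (c : Fin m) →
  ∑[ x < m ] ∑ᵛ k (λ v → 𝟙 (P x v ∧ allEqual (x ∷ c ∷ []))) ≡ ∑ᵛ k (λ v → 𝟙 (P c v))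
∑-identify-last k P c = trans (∑-identify k P c [])
  (∑ᵛ-cong k λ v → cong 𝟙 (trans (cong (P c v ∧_) (allEqual-[-] c)) (∧-identityʳ (P c v))))

allB-++ : ∀ {A : Set} (p : A → Bool) xs ys → allB p (xs ++ ys) ≡ allB p xs ∧ allB p ys
allB-++ p [] ys = refl
allB-++ p (x ∷ xs) ys = trans (cong (p x ∧_) (allB-++ p xs ys)) (sym (∧-assoc (p x) _ _))

allB-map : ∀ {A B : Set} (p : B → Bool) (h : A → B) xs → allB p (map h xs) ≡ allB (p ∘ h) xs
allB-map p h [] = refl
allB-map p h (x ∷ xs) = cong (p (h x) ∧_) (allB-map p h xs)

allB-concatMap : ∀ {A B : Set} (p : B → Bool) (h : A → List B) xs →
  allB p (concatMap h xs) ≡ allB (allB p ∘ h) xs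
allB-concatMap p h [] = refl
allB-concatMap p h (x ∷ xs) =
  trans (allB-++ p (h x) (concatMap h xs)) (cong (allB p (h x) ∧_) (allB-concatMap p h xs))

filterᵇ : ∀ {A : Set} → (A → Bool) → List A → List A
filterᵇ q [] = []
filterᵇ q (x ∷ xs) = if q x then x ∷ filterᵇ q xs else filterᵇ q xs

allB-if : ∀ {A : Set} (q p : A → Bool) xs →
  allB (λ x → if q x then p x else true) xs ≡ allB p (filterᵇ q xs)
allB-if q p [] = refl
allB-if q p (x ∷ xs) with q x
... | true = cong (p x ∧_) (allB-if q p xs)
... | false = allB-if q p xs

Edge : ℕ → Set
Edge k = Fin k × Fin k

holds : ∀ {k} {V : Set} → (V → V → Bool) → (Fin k → V) → List (Edge k) → Bool
holds A ρ = allB (λ e → A (ρ (proj₁ e)) (ρ (proj₂ e)))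

rename : ∀ {k} → Vec (Fin k) k → List (Edge k) → List (Edge k)
rename t = map (λ e → lookup t (proj₁ e) , lookup t (proj₂ e))

sameEdge : ∀ {k} → Edge k → Edge k → Bool
sameEdge (i , j) (k , l) = (⌊ i ≟ k ⌋ ∧ ⌊ j ≟ l ⌋) ∨ (⌊ i ≟ l ⌋ ∧ ⌊ j ≟ k ⌋)

memberᵉ : ∀ {k} → Edge k → List (Edge k) → Bool
memberᵉ e [] = false
memberᵉ e (e′ ∷ L) = sameEdge e e′ ∨ memberᵉ e L

_⊆ᵉ_ : ∀ {k} → List (Edge k) → List (Edge k) → Bool
L₁ ⊆ᵉ L₂ = allB (λ e → memberᵉ e L₂) L₁

_≋ᵉ_ : ∀ {k} → List (Edge k) → List (Edge k) → Bool
L₁ ≋ᵉ L₂ = (L₁ ⊆ᵉ L₂) ∧ (L₂ ⊆ᵉ L₁)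

module _ {k} {V : Set} (A : V → V → Bool) (A-sym : ∀ x y → A x y ≡ A y x) (ρ : Fin k → V) where

  holds-sameEdge : ∀ e e′ → sameEdge e e′ ≡ true →
    holds A ρ (e′ ∷ []) ≡ true → holds A ρ (e ∷ []) ≡ true
  holds-sameEdge (i , j) (i′ , j′) same h with ⌊ i ≟ i′ ⌋ ∧ ⌊ j ≟ j′ ⌋ in direct
  ... | true
    rewrite ≟-sound (∧-conicalˡ ⌊ i ≟ i′ ⌋ _ direct) | ≟-sound (∧-conicalʳ _ ⌊ j ≟ j′ ⌋ direct) = h
  ... | false
    rewrite ≟-sound (∧-conicalˡ ⌊ i ≟ j′ ⌋ _ same) | ≟-sound (∧-conicalʳ _ ⌊ j ≟ i′ ⌋ same) =
    trans (cong (_∧ true) (A-sym (ρ j′) (ρ i′))) h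

  holds-memberᵉ : ∀ e L → holds A ρ L ≡ true → memberᵉ e L ≡ true → holds A ρ (e ∷ []) ≡ true
  holds-memberᵉ e (e′ ∷ L) hL member with sameEdge e e′ in same
  ... | true = holds-sameEdge e e′ same (cong (_∧ true) (∧-conicalˡ _ _ hL))
  ... | false = holds-memberᵉ e L (∧-conicalʳ _ _ hL) member

  holds-⊆ᵉ : ∀ L₁ L₂ → L₁ ⊆ᵉ L₂ ≡ true → holds A ρ L₂ ≡ true → holds A ρ L₁ ≡ true
  holds-⊆ᵉ [] L₂ _ _ = refl
  holds-⊆ᵉ (e ∷ L₁) L₂ sub h = cong₂ _∧_
    (trans (sym (∧-identityʳ _)) (holds-memberᵉ e L₂ h (∧-conicalˡ _ _ sub)))
    (holds-⊆ᵉ L₁ L₂ (∧-conicalʳ _ _ sub) h)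

  holds-≋ᵉ : ∀ L₁ L₂ → L₁ ≋ᵉ L₂ ≡ true → holds A ρ L₁ ≡ holds A ρ L₂
  holds-≋ᵉ L₁ L₂ same =
    ⇔→≡ (mk⇔ (holds-⊆ᵉ L₂ L₁ (∧-conicalʳ _ _ same)) (holds-⊆ᵉ L₁ L₂ (∧-conicalˡ _ _ same)))

cubePairs : List (Cube × Cube)
cubePairs = concatMap (λ u → map (u ,_) (allBits 3)) (allBits 3)

Q₃-arcs : List (Cube × Cube)
Q₃-arcs = filterᵇ (λ e → Q3adj (proj₁ e) (proj₂ e)) cubePairs

binEdge : Cube × Cube → Edge 8
binEdge (u , v) = binIndex u , binIndex v

Q₃-edges : List (Edge 8)
Q₃-edges = map binEdge Q₃-arcs

isHom≡holds : ∀ G f → isHom G f ≡ holds (adj G) (lookup f) Q₃-edges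
isHom≡holds G f = begin
  isHom G f
    ≡⟨ allB-cong (λ u → sym (allB-map onPair (u ,_) (allBits 3))) (allBits 3) ⟩
  allB (λ u → allB onPair (map (u ,_) (allBits 3))) (allBits 3)
    ≡⟨ sym (allB-concatMap onPair (λ u → map (u ,_) (allBits 3)) (allBits 3)) ⟩
  allB onPair cubePairs
    ≡⟨ allB-if (λ e → Q3adj (proj₁ e) (proj₂ e)) onArc cubePairs ⟩
  allB onArc Q₃-arcs
    ≡⟨ sym (allB-map onEdge binEdge Q₃-arcs) ⟩
  holds (adj G) (lookup f) Q₃-edges ∎
  where
  open ≡-Reasoning
  onArc : Cube × Cube → Bool
  onArc (u , v) = adj G (apply G f u) (apply G f v)
  onPair : Cube × Cube → Bool
  onPair (u , v) = if Q3adj u v then onArc (u , v) else true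
  onEdge : Edge 8 → Bool
  onEdge (i , j) = adj G (lookup f i) (lookup f j)

-- Used with s sending each position to a representative of its class under
-- f, so that the first hypothesis holds by computation; the second is a
-- closed computation certifying that, up to orientation and repetition, the
-- edges of Q₃ (seen through s) are those of LA through tA and of LB through tB.
isHom-split : ∀ G (f : Vec (Fin (n G)) 8) (s tA tB : Vec (Fin 8) 8) (LA LB : List (Edge 8)) →
  holds (adj G) (lookup f) Q₃-edges ≡ holds (adj G) (lookup f) (rename s Q₃-edges) →
  rename s Q₃-edges ≋ᵉ (rename tA LA ++ rename tB LB) ≡ true →
  isHom G f ≡ holds (adj G) (lookup f) (rename tA LA) ∧ holds (adj G) (lookup f) (rename tB LB)
isHom-split G f s tA tB LA LB representatives same = begin
  isHom G f                                                   ≡⟨ isHom≡holds G f ⟩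
  holds (adj G) (lookup f) Q₃-edges                           ≡⟨ representatives ⟩
  holds (adj G) (lookup f) (rename s Q₃-edges)
    ≡⟨ holds-≋ᵉ (adj G) (adj-sym G) (lookup f) (rename s Q₃-edges) (rename tA LA ++ rename tB LB) same ⟩
  holds (adj G) (lookup f) (rename tA LA ++ rename tB LB)     ≡⟨ allB-++ _ (rename tA LA) (rename tB LB) ⟩
  holds (adj G) (lookup f) (rename tA LA) ∧ holds (adj G) (lookup f) (rename tB LB) ∎
  where open ≡-Reasoning

-- The two decompositions of Q₃
module _ (G : Graph) where

  private
    m = n G
    V = Fin m

  R₂ R₃ R₄ R₀₅ : List Cube
  R₂ = v000 ∷ v011 ∷ []
  R₃ = v000 ∷ v011 ∷ v101 ∷ []
  R₄ = v000 ∷ v011 ∷ v101 ∷ v110 ∷ []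
  R₀₅ = v000 ∷ v101 ∷ []

  -- xᵢ denotes the image of the vertex with binary value i, as in Map.
  H : Vec V 8 → ℕ
  H f = 𝟙 (isHom G f)

  -- Boundary of the first decomposition: y, d, x are the images of 111, 110,
  -- 001 and a is the image of 000 = 011. U₁ holds the edges at 010 (image o),
  -- V₁ those at 100 and 101 (images o and c); both also contain edges of the
  -- boundary. Edge lists refer to positions in the displayed tuple, whose
  -- other entries are placeholders.
  U₁-edges V₁-edges : List (Edge 8)
  U₁-edges = (0F , 1F) ∷ (0F , 7F) ∷ (6F , 7F) ∷ (0F , 2F) ∷ (2F , 6F) ∷ []
  V₁-edges = (0F , 4F) ∷ (4F , 5F) ∷ (4F , 6F) ∷ (0F , 1F) ∷ (1F , 5F) ∷ (5F , 7F) ∷ (6F , 7F) ∷ []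

  U₁ : V → V → V → V → V → Bool
  U₁ y d a x o = holds (adj G) (lookup (a ∷ x ∷ o ∷ a ∷ a ∷ a ∷ d ∷ y ∷ [])) U₁-edges

  V₁ : V → V → V → V → V → V → Bool
  V₁ y d a x c o = holds (adj G) (lookup (a ∷ x ∷ a ∷ a ∷ o ∷ c ∷ d ∷ y ∷ [])) V₁-edges

  u₁ : V → V → V → V → ℕ
  u₁ y d a x = ∑[ o < m ] 𝟙 (U₁ y d a x o)

  v₁ : V → V → V → V → ℕ
  v₁ y d a x = ∑[ c < m ] ∑[ o < m ] 𝟙 (V₁ y d a x c o)

  isHom≡V₁∧U₁ : ∀ x1 x2 x3 x4 x5 x6 x7 →
    isHom G (x3 ∷ x1 ∷ x2 ∷ x3 ∷ x4 ∷ x5 ∷ x6 ∷ x7 ∷ []) ≡ V₁ x7 x6 x3 x1 x5 x4 ∧ U₁ x7 x6 x3 x1 x2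
  isHom≡V₁∧U₁ x1 x2 x3 x4 x5 x6 x7 = isHom-split G (x3 ∷ x1 ∷ x2 ∷ x3 ∷ x4 ∷ x5 ∷ x6 ∷ x7 ∷ [])
    (3F ∷ 1F ∷ 2F ∷ 3F ∷ 4F ∷ 5F ∷ 6F ∷ 7F ∷ []) (3F ∷ 1F ∷ 3F ∷ 3F ∷ 4F ∷ 5F ∷ 6F ∷ 7F ∷ [])
    (3F ∷ 1F ∷ 2F ∷ 3F ∷ 3F ∷ 3F ∷ 6F ∷ 7F ∷ []) V₁-edges U₁-edges refl refl

  isHom≡U₁∧U₁ : ∀ x1 x2 x4 x5 x6 x7 →
    isHom G (x5 ∷ x1 ∷ x2 ∷ x5 ∷ x4 ∷ x5 ∷ x6 ∷ x7 ∷ []) ≡ U₁ x7 x6 x5 x1 x4 ∧ U₁ x7 x6 x5 x1 x2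
  isHom≡U₁∧U₁ x1 x2 x4 x5 x6 x7 = isHom-split G (x5 ∷ x1 ∷ x2 ∷ x5 ∷ x4 ∷ x5 ∷ x6 ∷ x7 ∷ [])
    (5F ∷ 1F ∷ 2F ∷ 5F ∷ 4F ∷ 5F ∷ 6F ∷ 7F ∷ []) (5F ∷ 1F ∷ 4F ∷ 5F ∷ 5F ∷ 5F ∷ 6F ∷ 7F ∷ [])
    (5F ∷ 1F ∷ 2F ∷ 5F ∷ 5F ∷ 5F ∷ 6F ∷ 7F ∷ []) U₁-edges U₁-edges refl refl

  isHom≡V₁∧V₁ : ∀ x0 x1 x2 x3 x4 x5 x6 x7 →
    isHom G (x0 ∷ x1 ∷ x2 ∷ x3 ∷ x4 ∷ x5 ∷ x6 ∷ x7 ∷ []) ≡ V₁ x7 x6 x0 x1 x5 x4 ∧ V₁ x7 x6 x0 x1 x3 x2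
  isHom≡V₁∧V₁ x0 x1 x2 x3 x4 x5 x6 x7 = isHom-split G (x0 ∷ x1 ∷ x2 ∷ x3 ∷ x4 ∷ x5 ∷ x6 ∷ x7 ∷ [])
    (0F ∷ 1F ∷ 2F ∷ 3F ∷ 4F ∷ 5F ∷ 6F ∷ 7F ∷ []) (0F ∷ 1F ∷ 0F ∷ 0F ∷ 4F ∷ 5F ∷ 6F ∷ 7F ∷ [])
    (0F ∷ 1F ∷ 0F ∷ 0F ∷ 2F ∷ 3F ∷ 6F ∷ 7F ∷ []) V₁-edges V₁-edges refl refl

  -- Boundary of the second decomposition: p, q are the images of 111, 010 and
  -- a is the image of 000 = 011 = 101. U₂ holds the edges at 001 (image r),
  -- V₂ those at 110 and 100 (images d and r).
  U₂-edges V₂-edges : List (Edge 8)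
  U₂-edges = (0F , 7F) ∷ (0F , 2F) ∷ (0F , 1F) ∷ []
  V₂-edges = (0F , 7F) ∷ (6F , 7F) ∷ (0F , 2F) ∷ (2F , 6F) ∷ (0F , 4F) ∷ (4F , 6F) ∷ []

  U₂ : V → V → V → V → Bool
  U₂ p a q r = holds (adj G) (lookup (a ∷ r ∷ q ∷ a ∷ a ∷ a ∷ a ∷ p ∷ [])) U₂-edges

  V₂ : V → V → V → V → V → Bool
  V₂ p a q d r = holds (adj G) (lookup (a ∷ a ∷ q ∷ a ∷ r ∷ a ∷ d ∷ p ∷ [])) V₂-edges

  u₂ : V → V → V → ℕ
  u₂ p a q = ∑[ r < m ] 𝟙 (U₂ p a q r)

  v₂ : V → V → V → ℕ
  v₂ p a q = ∑[ d < m ] ∑[ r < m ] 𝟙 (V₂ p a q d r)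

  isHom≡V₂∧U₂ : ∀ x1 x2 x4 x5 x6 x7 →
    isHom G (x5 ∷ x1 ∷ x2 ∷ x5 ∷ x4 ∷ x5 ∷ x6 ∷ x7 ∷ []) ≡ V₂ x7 x5 x2 x6 x4 ∧ U₂ x7 x5 x2 x1
  isHom≡V₂∧U₂ x1 x2 x4 x5 x6 x7 = isHom-split G (x5 ∷ x1 ∷ x2 ∷ x5 ∷ x4 ∷ x5 ∷ x6 ∷ x7 ∷ [])
    (5F ∷ 1F ∷ 2F ∷ 5F ∷ 4F ∷ 5F ∷ 6F ∷ 7F ∷ []) (5F ∷ 5F ∷ 2F ∷ 5F ∷ 4F ∷ 5F ∷ 6F ∷ 7F ∷ [])
    (5F ∷ 1F ∷ 2F ∷ 5F ∷ 5F ∷ 5F ∷ 5F ∷ 7F ∷ []) V₂-edges U₂-edges refl refl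

  isHom≡U₂∧U₂ : ∀ x1 x2 x4 x6 x7 →
    isHom G (x6 ∷ x1 ∷ x2 ∷ x6 ∷ x4 ∷ x6 ∷ x6 ∷ x7 ∷ []) ≡ U₂ x7 x6 x2 x4 ∧ U₂ x7 x6 x2 x1
  isHom≡U₂∧U₂ x1 x2 x4 x6 x7 = isHom-split G (x6 ∷ x1 ∷ x2 ∷ x6 ∷ x4 ∷ x6 ∷ x6 ∷ x7 ∷ [])
    (6F ∷ 1F ∷ 2F ∷ 6F ∷ 4F ∷ 6F ∷ 6F ∷ 7F ∷ []) (6F ∷ 4F ∷ 2F ∷ 6F ∷ 6F ∷ 6F ∷ 6F ∷ 7F ∷ [])
    (6F ∷ 1F ∷ 2F ∷ 6F ∷ 6F ∷ 6F ∷ 6F ∷ 7F ∷ []) U₂-edges U₂-edges refl refl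

  isHom≡V₂∧V₂ : ∀ x1 x2 x3 x4 x5 x6 x7 →
    isHom G (x5 ∷ x1 ∷ x2 ∷ x3 ∷ x4 ∷ x5 ∷ x6 ∷ x7 ∷ []) ≡ V₂ x7 x5 x2 x6 x4 ∧ V₂ x7 x5 x2 x3 x1
  isHom≡V₂∧V₂ x1 x2 x3 x4 x5 x6 x7 = isHom-split G (x5 ∷ x1 ∷ x2 ∷ x3 ∷ x4 ∷ x5 ∷ x6 ∷ x7 ∷ [])
    (5F ∷ 1F ∷ 2F ∷ 3F ∷ 4F ∷ 5F ∷ 6F ∷ 7F ∷ []) (5F ∷ 5F ∷ 2F ∷ 5F ∷ 4F ∷ 5F ∷ 6F ∷ 7F ∷ [])
    (5F ∷ 5F ∷ 2F ∷ 5F ∷ 1F ∷ 5F ∷ 3F ∷ 7F ∷ []) V₂-edges V₂-edges refl refl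

  -- These steps rely on computation: ∑ᵛ unfolds into nested sums with the
  -- last coordinate outermost, and constOn G f R computes, for an explicit R,
  -- to allEqual of the images of R.
  homR₂-collapse : homR G R₂ ≡
    ∑[ x7 < m ] ∑[ x6 < m ] ∑[ x5 < m ] ∑[ x4 < m ] ∑[ x3 < m ] ∑[ x2 < m ] ∑[ x1 < m ]
      H (x3 ∷ x1 ∷ x2 ∷ x3 ∷ x4 ∷ x5 ∷ x6 ∷ x7 ∷ [])
  homR₂-collapse = trans (homR≡∑ᵛ G R₂)
    (∑ᵛ-cong 7 λ v → ∑-identify-last 0 (λ x _ → isHom G (x ∷ v)) (lookup v 2F))

  homR₀₅-collapse : homR G R₀₅ ≡
    ∑[ x7 < m ] ∑[ x6 < m ] ∑[ x5 < m ] ∑[ x4 < m ] ∑[ x3 < m ] ∑[ x2 < m ] ∑[ x1 < m ]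
      H (x5 ∷ x1 ∷ x2 ∷ x3 ∷ x4 ∷ x5 ∷ x6 ∷ x7 ∷ [])
  homR₀₅-collapse = trans (homR≡∑ᵛ G R₀₅)
    (∑ᵛ-cong 7 λ v → ∑-identify-last 0 (λ x _ → isHom G (x ∷ v)) (lookup v 4F))

  homR₃-collapse : homR G R₃ ≡
    ∑[ x7 < m ] ∑[ x6 < m ] ∑[ x5 < m ] ∑[ x4 < m ] ∑[ x2 < m ] ∑[ x1 < m ]
      H (x5 ∷ x1 ∷ x2 ∷ x5 ∷ x4 ∷ x5 ∷ x6 ∷ x7 ∷ [])
  homR₃-collapse = begin
    homR G R₃
      ≡⟨ homR≡∑ᵛ G R₃ ⟩
    ∑ᵛ 8 (λ f → 𝟙 (isHom G f ∧ constOn G f R₃))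
      ≡⟨ ∑ᵛ-cong 7 (λ v → ∑-identify 0 (λ x _ → isHom G (x ∷ v)) (lookup v 2F) (lookup v 4F ∷ [])) ⟩
    ∑[ x7 < m ] ∑[ x6 < m ] ∑[ x5 < m ] ∑[ x4 < m ] ∑[ x3 < m ] ∑[ x2 < m ] ∑[ x1 < m ]
      𝟙 (isHom G (x3 ∷ x1 ∷ x2 ∷ x3 ∷ x4 ∷ x5 ∷ x6 ∷ x7 ∷ []) ∧ allEqual (x3 ∷ x5 ∷ []))
      ≡⟨ ∑ᵛ-cong 4 (λ w → ∑-identify-last 2
           (λ x u → isHom G (x ∷ lookup u 0F ∷ lookup u 1F ∷ x ∷ w)) (lookup w 1F)) ⟩
    ∑[ x7 < m ] ∑[ x6 < m ] ∑[ x5 < m ] ∑[ x4 < m ] ∑[ x2 < m ] ∑[ x1 < m ]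
      H (x5 ∷ x1 ∷ x2 ∷ x5 ∷ x4 ∷ x5 ∷ x6 ∷ x7 ∷ []) ∎
    where open ≡-Reasoning

  homR₄-collapse : homR G R₄ ≡
    ∑[ x7 < m ] ∑[ x6 < m ] ∑[ x4 < m ] ∑[ x2 < m ] ∑[ x1 < m ]
      H (x6 ∷ x1 ∷ x2 ∷ x6 ∷ x4 ∷ x6 ∷ x6 ∷ x7 ∷ [])
  homR₄-collapse = begin
    homR G R₄
      ≡⟨ homR≡∑ᵛ G R₄ ⟩
    ∑ᵛ 8 (λ f → 𝟙 (isHom G f ∧ constOn G f R₄))
      ≡⟨ ∑ᵛ-cong 7 (λ v →
           ∑-identify 0 (λ x _ → isHom G (x ∷ v)) (lookup v 2F) (lookup v 4F ∷ lookup v 5F ∷ [])) ⟩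
    ∑[ x7 < m ] ∑[ x6 < m ] ∑[ x5 < m ] ∑[ x4 < m ] ∑[ x3 < m ] ∑[ x2 < m ] ∑[ x1 < m ]
      𝟙 (isHom G (x3 ∷ x1 ∷ x2 ∷ x3 ∷ x4 ∷ x5 ∷ x6 ∷ x7 ∷ []) ∧ allEqual (x3 ∷ x5 ∷ x6 ∷ []))
      ≡⟨ ∑ᵛ-cong 4 (λ w → ∑-identify 2
           (λ x u → isHom G (x ∷ lookup u 0F ∷ lookup u 1F ∷ x ∷ w)) (lookup w 1F) (lookup w 2F ∷ [])) ⟩
    ∑[ x7 < m ] ∑[ x6 < m ] ∑[ x5 < m ] ∑[ x4 < m ] ∑[ x2 < m ] ∑[ x1 < m ]
      𝟙 (isHom G (x5 ∷ x1 ∷ x2 ∷ x5 ∷ x4 ∷ x5 ∷ x6 ∷ x7 ∷ []) ∧ allEqual (x5 ∷ x6 ∷ []))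
      ≡⟨ ∑ᵛ-cong 2 (λ w → ∑-identify-last 3
           (λ x u → isHom G (x ∷ lookup u 0F ∷ lookup u 1F ∷ x ∷ lookup u 2F ∷ x ∷ w)) (lookup w 0F)) ⟩
    ∑[ x7 < m ] ∑[ x6 < m ] ∑[ x4 < m ] ∑[ x2 < m ] ∑[ x1 < m ]
      H (x6 ∷ x1 ∷ x2 ∷ x6 ∷ x4 ∷ x6 ∷ x6 ∷ x7 ∷ []) ∎
    where open ≡-Reasoning

  homR₂≡∑v₁u₁ : homR G R₂ ≡ ∑[ y < m ] ∑[ d < m ] ∑[ a < m ] ∑[ x < m ] (v₁ y d a x * u₁ y d a x)
  homR₂≡∑v₁u₁ = begin
    homR G R₂
      ≡⟨ homR₂-collapse ⟩
    ∑[ x7 < m ] ∑[ x6 < m ] ∑[ x5 < m ] ∑[ x4 < m ] ∑[ x3 < m ] ∑[ x2 < m ] ∑[ x1 < m ]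
      H (x3 ∷ x1 ∷ x2 ∷ x3 ∷ x4 ∷ x5 ∷ x6 ∷ x7 ∷ [])
      ≡⟨ (∑-cong {m} λ x7 → ∑-cong {m} λ x6 → ∑-rotate₃ {m} _) ⟩
    ∑[ x7 < m ] ∑[ x6 < m ] ∑[ x3 < m ] ∑[ x5 < m ] ∑[ x4 < m ] ∑[ x2 < m ] ∑[ x1 < m ]
      H (x3 ∷ x1 ∷ x2 ∷ x3 ∷ x4 ∷ x5 ∷ x6 ∷ x7 ∷ [])
      ≡⟨ (∑-cong {m} λ x7 → ∑-cong {m} λ x6 → ∑-cong {m} λ x3 → ∑-rotate₄ {m} _) ⟩
    ∑[ x7 < m ] ∑[ x6 < m ] ∑[ x3 < m ] ∑[ x1 < m ] ∑[ x5 < m ] ∑[ x4 < m ] ∑[ x2 < m ]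
      H (x3 ∷ x1 ∷ x2 ∷ x3 ∷ x4 ∷ x5 ∷ x6 ∷ x7 ∷ [])
      ≡⟨ (∑-cong {m} λ x7 → ∑-cong {m} λ x6 → ∑-cong {m} λ x3 → ∑-cong {m} λ x1 → trans
           (∑-cong {m} λ x5 → ∑-cong {m} λ x4 → ∑-cong {m} λ x2 →
             trans (cong 𝟙 (isHom≡V₁∧U₁ x1 x2 x3 x4 x5 x6 x7))
                   (𝟙-∧ (V₁ x7 x6 x3 x1 x5 x4) (U₁ x7 x6 x3 x1 x2)))
           (sym (∑₂-product-∑ (λ x5 x4 → 𝟙 (V₁ x7 x6 x3 x1 x5 x4)) (λ x2 → 𝟙 (U₁ x7 x6 x3 x1 x2))))) ⟩
    ∑[ y < m ] ∑[ d < m ] ∑[ a < m ] ∑[ x < m ] (v₁ y d a x * u₁ y d a x) ∎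
    where open ≡-Reasoning

  homR₃≡∑u₁u₁ : homR G R₃ ≡ ∑[ y < m ] ∑[ d < m ] ∑[ a < m ] ∑[ x < m ] (u₁ y d a x * u₁ y d a x)
  homR₃≡∑u₁u₁ = begin
    homR G R₃
      ≡⟨ homR₃-collapse ⟩
    ∑[ x7 < m ] ∑[ x6 < m ] ∑[ x5 < m ] ∑[ x4 < m ] ∑[ x2 < m ] ∑[ x1 < m ]
      H (x5 ∷ x1 ∷ x2 ∷ x5 ∷ x4 ∷ x5 ∷ x6 ∷ x7 ∷ [])
      ≡⟨ (∑-cong {m} λ x7 → ∑-cong {m} λ x6 → ∑-cong {m} λ x5 → ∑-rotate₃ {m} _) ⟩
    ∑[ x7 < m ] ∑[ x6 < m ] ∑[ x5 < m ] ∑[ x1 < m ] ∑[ x4 < m ] ∑[ x2 < m ]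
      H (x5 ∷ x1 ∷ x2 ∷ x5 ∷ x4 ∷ x5 ∷ x6 ∷ x7 ∷ [])
      ≡⟨ (∑-cong {m} λ x7 → ∑-cong {m} λ x6 → ∑-cong {m} λ x5 → ∑-cong {m} λ x1 → trans
           (∑-cong {m} λ x4 → ∑-cong {m} λ x2 →
             trans (cong 𝟙 (isHom≡U₁∧U₁ x1 x2 x4 x5 x6 x7)) (𝟙-∧ (U₁ x7 x6 x5 x1 x4) (U₁ x7 x6 x5 x1 x2)))
           (sym (∑-product (λ x4 → 𝟙 (U₁ x7 x6 x5 x1 x4)) (λ x2 → 𝟙 (U₁ x7 x6 x5 x1 x2))))) ⟩
    ∑[ y < m ] ∑[ d < m ] ∑[ a < m ] ∑[ x < m ] (u₁ y d a x * u₁ y d a x) ∎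
    where open ≡-Reasoning

  hom≡∑v₁v₁ : hom G ≡ ∑[ y < m ] ∑[ d < m ] ∑[ a < m ] ∑[ x < m ] (v₁ y d a x * v₁ y d a x)
  hom≡∑v₁v₁ = begin
    hom G
      ≡⟨ hom≡∑ᵛ G ⟩
    ∑[ x7 < m ] ∑[ x6 < m ] ∑[ x5 < m ] ∑[ x4 < m ] ∑[ x3 < m ] ∑[ x2 < m ] ∑[ x1 < m ] ∑[ x0 < m ]
      H (x0 ∷ x1 ∷ x2 ∷ x3 ∷ x4 ∷ x5 ∷ x6 ∷ x7 ∷ [])
      ≡⟨ (∑-cong {m} λ x7 → ∑-cong {m} λ x6 → ∑-rotate₆ {m} _) ⟩
    ∑[ x7 < m ] ∑[ x6 < m ] ∑[ x0 < m ] ∑[ x5 < m ] ∑[ x4 < m ] ∑[ x3 < m ] ∑[ x2 < m ] ∑[ x1 < m ]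
      H (x0 ∷ x1 ∷ x2 ∷ x3 ∷ x4 ∷ x5 ∷ x6 ∷ x7 ∷ [])
      ≡⟨ (∑-cong {m} λ x7 → ∑-cong {m} λ x6 → ∑-cong {m} λ x0 → ∑-rotate₅ {m} _) ⟩
    ∑[ x7 < m ] ∑[ x6 < m ] ∑[ x0 < m ] ∑[ x1 < m ] ∑[ x5 < m ] ∑[ x4 < m ] ∑[ x3 < m ] ∑[ x2 < m ]
      H (x0 ∷ x1 ∷ x2 ∷ x3 ∷ x4 ∷ x5 ∷ x6 ∷ x7 ∷ [])
      ≡⟨ (∑-cong {m} λ x7 → ∑-cong {m} λ x6 → ∑-cong {m} λ x0 → ∑-cong {m} λ x1 → trans
           (∑-cong {m} λ x5 → ∑-cong {m} λ x4 → ∑-cong {m} λ x3 → ∑-cong {m} λ x2 →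
             trans (cong 𝟙 (isHom≡V₁∧V₁ x0 x1 x2 x3 x4 x5 x6 x7))
                   (𝟙-∧ (V₁ x7 x6 x0 x1 x5 x4) (V₁ x7 x6 x0 x1 x3 x2)))
           (sym (∑₂-product-∑₂ (λ x5 x4 → 𝟙 (V₁ x7 x6 x0 x1 x5 x4)) (λ x3 x2 → 𝟙 (V₁ x7 x6 x0 x1 x3 x2))))) ⟩
    ∑[ y < m ] ∑[ d < m ] ∑[ a < m ] ∑[ x < m ] (v₁ y d a x * v₁ y d a x) ∎
    where open ≡-Reasoning

  homR₃≡∑v₂u₂ : homR G R₃ ≡ ∑[ p < m ] ∑[ a < m ] ∑[ q < m ] (v₂ p a q * u₂ p a q)
  homR₃≡∑v₂u₂ = begin
    homR G R₃
      ≡⟨ homR₃-collapse ⟩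
    ∑[ x7 < m ] ∑[ x6 < m ] ∑[ x5 < m ] ∑[ x4 < m ] ∑[ x2 < m ] ∑[ x1 < m ]
      H (x5 ∷ x1 ∷ x2 ∷ x5 ∷ x4 ∷ x5 ∷ x6 ∷ x7 ∷ [])
      ≡⟨ (∑-cong {m} λ x7 → ∑-comm {m} {m} _) ⟩
    ∑[ x7 < m ] ∑[ x5 < m ] ∑[ x6 < m ] ∑[ x4 < m ] ∑[ x2 < m ] ∑[ x1 < m ]
      H (x5 ∷ x1 ∷ x2 ∷ x5 ∷ x4 ∷ x5 ∷ x6 ∷ x7 ∷ [])
      ≡⟨ (∑-cong {m} λ x7 → ∑-cong {m} λ x5 → ∑-rotate₃ {m} _) ⟩
    ∑[ x7 < m ] ∑[ x5 < m ] ∑[ x2 < m ] ∑[ x6 < m ] ∑[ x4 < m ] ∑[ x1 < m ]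
      H (x5 ∷ x1 ∷ x2 ∷ x5 ∷ x4 ∷ x5 ∷ x6 ∷ x7 ∷ [])
      ≡⟨ (∑-cong {m} λ x7 → ∑-cong {m} λ x5 → ∑-cong {m} λ x2 → trans
           (∑-cong {m} λ x6 → ∑-cong {m} λ x4 → ∑-cong {m} λ x1 →
             trans (cong 𝟙 (isHom≡V₂∧U₂ x1 x2 x4 x5 x6 x7)) (𝟙-∧ (V₂ x7 x5 x2 x6 x4) (U₂ x7 x5 x2 x1)))
           (sym (∑₂-product-∑ (λ x6 x4 → 𝟙 (V₂ x7 x5 x2 x6 x4)) (λ x1 → 𝟙 (U₂ x7 x5 x2 x1))))) ⟩
    ∑[ p < m ] ∑[ a < m ] ∑[ q < m ] (v₂ p a q * u₂ p a q) ∎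
    where open ≡-Reasoning

  homR₄≡∑u₂u₂ : homR G R₄ ≡ ∑[ p < m ] ∑[ a < m ] ∑[ q < m ] (u₂ p a q * u₂ p a q)
  homR₄≡∑u₂u₂ = begin
    homR G R₄
      ≡⟨ homR₄-collapse ⟩
    ∑[ x7 < m ] ∑[ x6 < m ] ∑[ x4 < m ] ∑[ x2 < m ] ∑[ x1 < m ]
      H (x6 ∷ x1 ∷ x2 ∷ x6 ∷ x4 ∷ x6 ∷ x6 ∷ x7 ∷ [])
      ≡⟨ (∑-cong {m} λ x7 → ∑-cong {m} λ x6 → ∑-comm {m} {m} _) ⟩
    ∑[ x7 < m ] ∑[ x6 < m ] ∑[ x2 < m ] ∑[ x4 < m ] ∑[ x1 < m ]
      H (x6 ∷ x1 ∷ x2 ∷ x6 ∷ x4 ∷ x6 ∷ x6 ∷ x7 ∷ [])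
      ≡⟨ (∑-cong {m} λ x7 → ∑-cong {m} λ x6 → ∑-cong {m} λ x2 → trans
           (∑-cong {m} λ x4 → ∑-cong {m} λ x1 →
             trans (cong 𝟙 (isHom≡U₂∧U₂ x1 x2 x4 x6 x7)) (𝟙-∧ (U₂ x7 x6 x2 x4) (U₂ x7 x6 x2 x1)))
           (sym (∑-product (λ x4 → 𝟙 (U₂ x7 x6 x2 x4)) (λ x1 → 𝟙 (U₂ x7 x6 x2 x1))))) ⟩
    ∑[ p < m ] ∑[ a < m ] ∑[ q < m ] (u₂ p a q * u₂ p a q) ∎
    where open ≡-Reasoning

  homR₀₅≡∑v₂v₂ : homR G R₀₅ ≡ ∑[ p < m ] ∑[ a < m ] ∑[ q < m ] (v₂ p a q * v₂ p a q)
  homR₀₅≡∑v₂v₂ = begin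
    homR G R₀₅
      ≡⟨ homR₀₅-collapse ⟩
    ∑[ x7 < m ] ∑[ x6 < m ] ∑[ x5 < m ] ∑[ x4 < m ] ∑[ x3 < m ] ∑[ x2 < m ] ∑[ x1 < m ]
      H (x5 ∷ x1 ∷ x2 ∷ x3 ∷ x4 ∷ x5 ∷ x6 ∷ x7 ∷ [])
      ≡⟨ (∑-cong {m} λ x7 → ∑-comm {m} {m} _) ⟩
    ∑[ x7 < m ] ∑[ x5 < m ] ∑[ x6 < m ] ∑[ x4 < m ] ∑[ x3 < m ] ∑[ x2 < m ] ∑[ x1 < m ]
      H (x5 ∷ x1 ∷ x2 ∷ x3 ∷ x4 ∷ x5 ∷ x6 ∷ x7 ∷ [])
      ≡⟨ (∑-cong {m} λ x7 → ∑-cong {m} λ x5 → ∑-rotate₄ {m} _) ⟩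
    ∑[ x7 < m ] ∑[ x5 < m ] ∑[ x2 < m ] ∑[ x6 < m ] ∑[ x4 < m ] ∑[ x3 < m ] ∑[ x1 < m ]
      H (x5 ∷ x1 ∷ x2 ∷ x3 ∷ x4 ∷ x5 ∷ x6 ∷ x7 ∷ [])
      ≡⟨ (∑-cong {m} λ x7 → ∑-cong {m} λ x5 → ∑-cong {m} λ x2 → trans
           (∑-cong {m} λ x6 → ∑-cong {m} λ x4 → ∑-cong {m} λ x3 → ∑-cong {m} λ x1 →
             trans (cong 𝟙 (isHom≡V₂∧V₂ x1 x2 x3 x4 x5 x6 x7)) (𝟙-∧ (V₂ x7 x5 x2 x6 x4) (V₂ x7 x5 x2 x3 x1)))
           (sym (∑₂-product-∑₂ (λ x6 x4 → 𝟙 (V₂ x7 x5 x2 x6 x4)) (λ x3 x1 → 𝟙 (V₂ x7 x5 x2 x3 x1))))) ⟩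
    ∑[ p < m ] ∑[ a < m ] ∑[ q < m ] (v₂ p a q * v₂ p a q) ∎
    where open ≡-Reasoning

  homR₂²≤homR₃*hom : homR G R₂ * homR G R₂ ≤ homR G R₃ * hom G
  homR₂²≤homR₃*hom = begin
    homR G R₂ * homR G R₂
      ≡⟨ cong₂ _*_ homR₂≡∑v₁u₁ homR₂≡∑v₁u₁ ⟩
    (∑[ y < m ] ∑[ d < m ] ∑[ a < m ] ∑[ x < m ] (v₁ y d a x * u₁ y d a x))
      * (∑[ y < m ] ∑[ d < m ] ∑[ a < m ] ∑[ x < m ] (v₁ y d a x * u₁ y d a x))
      ≤⟨ (∑-cauchy-schwarz {m} λ y → ∑-cauchy-schwarz {m} λ d →
          ∑-cauchy-schwarz {m} λ a → ∑-cauchy-schwarz {m} λ x → product-square-≤ (v₁ y d a x) (u₁ y d a x)) ⟩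
    (∑[ y < m ] ∑[ d < m ] ∑[ a < m ] ∑[ x < m ] (u₁ y d a x * u₁ y d a x))
      * (∑[ y < m ] ∑[ d < m ] ∑[ a < m ] ∑[ x < m ] (v₁ y d a x * v₁ y d a x))
      ≡⟨ cong₂ _*_ homR₃≡∑u₁u₁ hom≡∑v₁v₁ ⟨
    homR G R₃ * hom G ∎
    where open ≤-Reasoning

  homR₃²≤homR₄*hom : homR G R₃ * homR G R₃ ≤ homR G R₄ * hom G
  homR₃²≤homR₄*hom = begin
    homR G R₃ * homR G R₃
      ≡⟨ cong₂ _*_ homR₃≡∑v₂u₂ homR₃≡∑v₂u₂ ⟩
    (∑[ p < m ] ∑[ a < m ] ∑[ q < m ] (v₂ p a q * u₂ p a q))
      * (∑[ p < m ] ∑[ a < m ] ∑[ q < m ] (v₂ p a q * u₂ p a q))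
      ≤⟨ (∑-cauchy-schwarz {m} λ p → ∑-cauchy-schwarz {m} λ a → ∑-cauchy-schwarz {m} λ q →
           product-square-≤ (v₂ p a q) (u₂ p a q)) ⟩
    (∑[ p < m ] ∑[ a < m ] ∑[ q < m ] (u₂ p a q * u₂ p a q))
      * (∑[ p < m ] ∑[ a < m ] ∑[ q < m ] (v₂ p a q * v₂ p a q))
      ≡⟨ cong₂ _*_ homR₄≡∑u₂u₂ homR₀₅≡∑v₂v₂ ⟨
    homR G R₄ * homR G R₀₅
      ≤⟨ *-monoʳ-≤ (homR G R₄) (homR≤hom G R₀₅) ⟩
    homR G R₄ * hom G ∎
    where open ≤-Reasoning

lemma2p2 : (G : Graph) →
    (homR G (v000 ∷ v011 ∷ []) * homR G (v000 ∷ v011 ∷ [])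
      ≤ homR G (v000 ∷ v011 ∷ v101 ∷ []) * hom G)
    × (homR G (v000 ∷ v011 ∷ v101 ∷ []) * homR G (v000 ∷ v011 ∷ v101 ∷ [])
      ≤ homR G (v000 ∷ v011 ∷ v101 ∷ v110 ∷ []) * hom G)
lemma2p2 G = homR₂²≤homR₃*hom G , homR₃²≤homR₄*hom G
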